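{- Let $\alpha\in\mathbb Z\setminus\{ -1,0\}$ and let $(h_n)$ be the sequence with $h_0=0$, $h_1=1$, $h_2=-\alpha(\alpha+1)$, $h_3=-\alpha^3(\alpha+1)^3$, $h_4=\alpha^6(\alpha+1)^5$, and for $m\ge2$: $h_{2m+1}=h_{m+2}h_m^3-h_{m-1}h_{m+1}^3$, for $m\ge 3$: $h_{2m}=h_m\big(h_{m+2}h_{m-1}^2-h_{m-2}h_{m+1}^2\big)/h_2$. (i) If $n\equiv 4,8\pmod{12}$, then $h_n$ is a square if and only if $\alpha+1$ is a square. (ii) If $n\equiv 4,14\pmod{18}$, then $h_n$ is a cube if and only if $\alpha+1$ is a cube. (iii) If $n\equiv 8,10\pmod{18}$, then $h_n$ is a cube if and only if $\alpha$ is a cube.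
   Context: The sequence defined is the elliptic divisibility sequence attached to the point $(0,0)$ of order $6$ on the Tate normal form curve with $b=\alpha+\alpha^2$, $c=\alpha$. Convention: an integer $m$ is called a square if $m=\pm\beta^2$ for some nonzero integer $\beta$, and a cube if $m=\beta^3$ for some nonzero integer $\beta$. -}

module Defs where

open import Data.Nat as ℕ using (ℕ; zero; suc; _∸_; ⌊_/2⌋)
open import Data.Nat.Base using (_%_)
open import Data.Integer as ℤ using (ℤ; +_; -_; _*_; _-_; _+_; _^_; 0ℤ; 1ℤ)
open import Data.Integer.DivMod using (_/_)
open import Data.Integer.Base using (≢-nonZero)
open import Data.Product using (Σ; _×_; ∃; _,_)
open import Data.Sum using (_⊎_)
open import Relation.Nullary using (¬_; yes; no)
open import Relation.Binary.PropositionalEquality using (_≡_; _≢_)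

-- Total integer division: a / b (floor), and 0 when b = 0.
-- In the sequence below it is only used with divisor h₂ = -α(α+1) ≠ 0
-- (α ∉ {-1,0}), where the division is exact.
divℤ : ℤ → ℤ → ℤ
divℤ a b with b ℤ.≟ 0ℤ
... | yes _ = 0ℤ
... | no b≢0 = _/_ a b {{≢-nonZero b≢0}}

module _ (α : ℤ) where

  private
    h₂ h₃ h₄ : ℤ
    h₂ = - (α * (α + 1ℤ))
    h₃ = - ((α ^ 3) * ((α + 1ℤ) ^ 3))
    h₄ = (α ^ 6) * ((α + 1ℤ) ^ 5)

  -- hf fuel n : fuel-bounded evaluation; correct whenever n ≤ fuel,
  -- since every recursive call is at an index strictly smaller than n.
  hf : ℕ → ℕ → ℤ
  hf zero _ = 0ℤ
  hf (suc f) 0 = 0ℤ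
  hf (suc f) 1 = 1ℤ
  hf (suc f) 2 = h₂
  hf (suc f) 3 = h₃
  hf (suc f) 4 = h₄
  hf (suc f) n@(suc (suc (suc (suc (suc _))))) with n % 2
  ... | 0 =
    let m = ⌊ n /2⌋ ; h = hf f in
    divℤ (h m * (h (m ℕ.+ 2) * (h (m ∸ 1) ^ 2) - h (m ∸ 2) * (h (m ℕ.+ 1) ^ 2))) h₂
  ... | _ =
    let m = ⌊ n /2⌋ ; h = hf f in
    h (m ℕ.+ 2) * (h m ^ 3) - h (m ∸ 1) * (h (m ℕ.+ 1) ^ 3)

  hseq : ℕ → ℤ
  hseq n = hf n n

IsSquare : ℤ → Set
IsSquare m = Σ ℤ λ β → β ≢ 0ℤ × (m ≡ β * β ⊎ m ≡ - (β * β))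

IsCube : ℤ → Set
IsCube m = Σ ℤ λ β → β ≢ 0ℤ × m ≡ β * β * β

module Submission where

open import Defs
open import Data.Nat using (ℕ; _%_)
open import Data.Integer using (ℤ; 0ℤ; 1ℤ; -1ℤ; _+_)
open import Data.Sum using (_⊎_)
open import Data.Product using (_×_)
open import Function.Bundles using (_⇔_)
open import Relation.Binary.PropositionalEquality using (_≡_; _≢_)

open import Data.Nat as ℕ using (zero; suc; NonZero; _∸_; _≤_; _<_; z≤n; s≤s; ⌊_/2⌋)
import Data.Nat.Properties as ℕP
import Data.Nat.DivMod as ℕD
import Data.Nat.Divisibility as ℕ∣
open import Data.Nat.GCD using (gcd; gcd[m,n]∣m; gcd[m,n]∣n; gcd[m,n]≢0)
open import Data.Nat.Coprimality using (Coprime; coprime-divisor; coprime-/gcd)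
import Data.Nat.Tactic.RingSolver as ℕSolver
open import Data.Integer as ℤ using (+_; -_; _-_; _*_; _^_)
import Data.Integer.Properties as ℤP
import Data.Integer.DivMod as ℤD
open import Data.Integer.Base using (≢-nonZero)
open import Data.Integer.Divisibility.Signed as ℤ∣ using (∣ᵤ⇒∣)
open import Data.Integer.Tactic.RingSolver using (solve-∀)
open import Data.Sign.Base as Sign using (Sign; opposite)
open import Data.Product using (Σ; ∃₂; _,_)
open import Data.Sum using (inj₁; inj₂)
open import Data.Empty using (⊥-elim)
open import Relation.Nullary using (yes; no)
open import Function.Bundles using (mk⇔)
import Function.Properties.Equivalence as ⇔
open import Relation.Binary.PropositionalEquality using (refl; sym; trans; cong; cong₂; subst; subst₂; module ≡-Reasoning)

-- Proof of Theorem 5.6.  Write a = α, b = α + 1, t = a¹⁵b¹² and w = −a⁵b⁴,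
-- so that t² = w⁶.  The sequence has an explicit closed form: h₀,…,h₅ are
-- 0, 1, −ab, −a³b³, a⁶b⁵, a¹⁰b⁸ and h_{6+s} = t·wˢ·h_s, hence every h_n is
-- zero or a signed monomial ±aⁱbʲ, and iterating gives the quasi-periodicity
-- h_{6K+s} = t^{K²}·(w^K)ˢ·h_s.
--   1. Signed monomials, their product and the few subtractions of monomials
--      that stay monomials when b = a + 1.
--   2. The closed form cf and its quasi-periodicity.
--   3. The duplication formulas of the sequence are local, commute with index
--      shifts and are homogeneous under h_s ↦ Z·Yˢ·h_s; with quasi-periodicity
--      this reduces them for cf to twelve base cases (2 ≤ m ≤ 7, 3 ≤ m ≤ 8),
--      each a computation with monomials.
--   4. By induction on the fuel of its definition, hseq α = cf (the division by
--      h₂ = −ab ≠ 0 is exact).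
--   5. Elementary divisibility: yᵏ ∣ zᵏ ⇒ y ∣ z, so Y²c is a square iff c is,
--      and Y³c² is a cube iff c is (Y, c ≠ 0).
--   6. For n ≡ s modulo 12 or 18, quasi-periodicity makes h_n an e-th power
--      (e = 2, 3) times h_s, and h_s is an e-th power times ±b, b² or a².

*-≢0 : ∀ {x y} → x ≢ 0ℤ → y ≢ 0ℤ → x * y ≢ 0ℤ
*-≢0 {x} x≢0 y≢0 xy≡0 with ℤP.i*j≡0⇒i≡0∨j≡0 x xy≡0
... | inj₁ x≡0 = x≢0 x≡0
... | inj₂ y≡0 = y≢0 y≡0

^-≢0 : ∀ {x} n → x ≢ 0ℤ → x ^ n ≢ 0ℤ
^-≢0 {x} n x≢0 xⁿ≡0 = x≢0 (ℤP.i^n≡0⇒i≡0 x n xⁿ≡0)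

+1≢0 : ∀ {α} → α ≢ -1ℤ → α + 1ℤ ≢ 0ℤ
+1≢0 {α} α≢-1 eq = α≢-1 (trans (sym (add-sub α)) (cong (_+ -1ℤ) eq))
  where
  add-sub : ∀ a → a + 1ℤ + -1ℤ ≡ a
  add-sub = solve-∀

^-distrib-* : ∀ x y n → (x * y) ^ n ≡ x ^ n * y ^ n
^-distrib-* x y zero    = refl
^-distrib-* x y (suc n) = trans (cong (x * y *_) (^-distrib-* x y n)) (interchange x y (x ^ n) (y ^ n))
  where
  interchange : ∀ x y x′ y′ → x * y * (x′ * y′) ≡ x * x′ * (y * y′)
  interchange = solve-∀

ℕ-^-distrib-* : ∀ x y n → (x ℕ.* y) ℕ.^ n ≡ x ℕ.^ n ℕ.* y ℕ.^ n
ℕ-^-distrib-* x y zero    = refl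
ℕ-^-distrib-* x y (suc n) = trans (cong (x ℕ.* y ℕ.*_) (ℕ-^-distrib-* x y n)) (interchange x y (x ℕ.^ n) (y ℕ.^ n))
  where
  interchange : ∀ x y x′ y′ → x ℕ.* y ℕ.* (x′ ℕ.* y′) ≡ x ℕ.* x′ ℕ.* (y ℕ.* y′)
  interchange = ℕSolver.solve-∀


-- A signed monomial ± aⁱbʲ in two variables a, b, or zero; the values of
-- the sequence are of this form.  Products and powers are computed on the
-- exponents, so identities between monomials hold by computation.
data Mono : Set where
  0ᵐ  : Mono
  mon : Sign → ℕ → ℕ → Mono

infixl 7 _·_
_·_ : Mono → Mono → Mono
0ᵐ          · _            = 0ᵐ
mon _ _ _   · 0ᵐ           = 0ᵐ
mon s i j   · mon s′ i′ j′ = mon (s Sign.* s′) (i ℕ.+ i′) (j ℕ.+ j′)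

infixr 8 _^ᵐ_
_^ᵐ_ : Mono → ℕ → Mono
m ^ᵐ zero  = mon Sign.+ 0 0
m ^ᵐ suc k = m · m ^ᵐ k

-- The elementary subtractions of monomials that are themselves monomials,
-- valid under the relation b = a + 1 (the last two use b − 1 = a).
infix 4 _─_≐_
data _─_≐_ : Mono → Mono → Mono → Set where
  minus-zero : ∀ {m} → m ─ 0ᵐ ≐ m
  zero-minus : ∀ {s i j} → 0ᵐ ─ mon s i j ≐ mon (opposite s) i j
  self       : ∀ {m} → m ─ m ≐ 0ᵐ
  b-minus-1  : ∀ {s i j} → mon s i (suc j) ─ mon s i j ≐ mon s (suc i) j
  1-minus-b  : ∀ {s i j} → mon s i j ─ mon s i (suc j) ≐ mon (opposite s) (suc i) j

signed : Sign → ℤ → ℤ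
signed Sign.+ x = x
signed Sign.- x = - x

signed-* : ∀ s s′ x y → signed (s Sign.* s′) (x * y) ≡ signed s x * signed s′ y
signed-* Sign.+ Sign.+ x y = refl
signed-* Sign.+ Sign.- x y = ℤP.neg-distribʳ-* x y
signed-* Sign.- Sign.+ x y = ℤP.neg-distribˡ-* x y
signed-* Sign.- Sign.- x y = negate-both x y
  where
  negate-both : ∀ x y → x * y ≡ - x * - y
  negate-both = solve-∀

signed-─ : ∀ s x y → signed s x - signed s y ≡ signed s (x - y)
signed-─ Sign.+ x y = refl
signed-─ Sign.- x y = sym (ℤP.neg-distrib-+ x (- y))

signed-opposite : ∀ s x → - signed s x ≡ signed (opposite s) x
signed-opposite Sign.+ x = refl
signed-opposite Sign.- x = ℤP.neg-involutive x

signed-neg : ∀ s x → signed s (- x) ≡ signed (opposite s) x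
signed-neg Sign.+ x = refl
signed-neg Sign.- x = ℤP.neg-involutive x

signed-≡0 : ∀ s {x} → signed s x ≡ 0ℤ → x ≡ 0ℤ
signed-≡0 Sign.+ eq = eq
signed-≡0 Sign.- eq = trans (sym (ℤP.neg-involutive _)) (cong -_ eq)

module Evaluation (a b : ℤ) where

  ⟦_⟧ : Mono → ℤ
  ⟦ 0ᵐ ⟧       = 0ℤ
  ⟦ mon s i j ⟧ = signed s (a ^ i * b ^ j)

  ⟦·⟧ : ∀ m n → ⟦ m · n ⟧ ≡ ⟦ m ⟧ * ⟦ n ⟧
  ⟦·⟧ 0ᵐ          n            = refl
  ⟦·⟧ m@(mon _ _ _) 0ᵐ           = sym (ℤP.*-zeroʳ ⟦ m ⟧)
  ⟦·⟧ (mon s i j) (mon s′ i′ j′) = begin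
    signed (s Sign.* s′) (a ^ (i ℕ.+ i′) * b ^ (j ℕ.+ j′))
      ≡⟨ cong₂ (λ x y → signed (s Sign.* s′) (x * y)) (ℤP.^-distribˡ-+-* a i i′) (ℤP.^-distribˡ-+-* b j j′) ⟩
    signed (s Sign.* s′) (a ^ i * a ^ i′ * (b ^ j * b ^ j′))
      ≡⟨ cong (signed (s Sign.* s′)) (interchange (a ^ i) (a ^ i′) (b ^ j) (b ^ j′)) ⟩
    signed (s Sign.* s′) (a ^ i * b ^ j * (a ^ i′ * b ^ j′))
      ≡⟨ signed-* s s′ _ _ ⟩
    signed s (a ^ i * b ^ j) * signed s′ (a ^ i′ * b ^ j′) ∎
    where
    open ≡-Reasoning
    interchange : ∀ x x′ y y′ → x * x′ * (y * y′) ≡ x * y * (x′ * y′)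
    interchange = solve-∀

  ⟦^⟧ : ∀ m k → ⟦ m ^ᵐ k ⟧ ≡ ⟦ m ⟧ ^ k
  ⟦^⟧ m zero    = refl
  ⟦^⟧ m (suc k) = trans (⟦·⟧ m (m ^ᵐ k)) (cong (⟦ m ⟧ *_) (⟦^⟧ m k))

  ⟦─⟧ : b ≡ a + 1ℤ → ∀ {m n d} → m ─ n ≐ d → ⟦ m ⟧ - ⟦ n ⟧ ≡ ⟦ d ⟧
  ⟦─⟧ _ {m} minus-zero = ℤP.+-identityʳ ⟦ m ⟧
  ⟦─⟧ _ {n = mon s i j} zero-minus = trans (ℤP.+-identityˡ _) (signed-opposite s _)
  ⟦─⟧ _ {m} self = ℤP.+-inverseʳ ⟦ m ⟧
  ⟦─⟧ refl {mon s i (suc j)} b-minus-1 =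
    trans (signed-─ s _ _) (cong (signed s) (b-minus-1≡a a (a ^ i) (b ^ j)))
    where
    b-minus-1≡a : ∀ a A B → A * ((a + 1ℤ) * B) - A * B ≡ a * A * B
    b-minus-1≡a = solve-∀
  ⟦─⟧ refl {mon s i j} 1-minus-b =
    trans (signed-─ s _ _) (trans (cong (signed s) (1-minus-b≡-a a (a ^ i) (b ^ j))) (signed-neg s _))
    where
    1-minus-b≡-a : ∀ a A B → A * B - A * ((a + 1ℤ) * B) ≡ - (a * A * B)
    1-minus-b≡-a = solve-∀

  mon≢0 : a ≢ 0ℤ → b ≢ 0ℤ → ∀ s i j → ⟦ mon s i j ⟧ ≢ 0ℤ
  mon≢0 a≢0 b≢0 s i j eq = *-≢0 (^-≢0 i a≢0) (^-≢0 j b≢0) (signed-≡0 s eq)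

tᵐ wᵐ : Mono
tᵐ = mon Sign.+ 15 12
wᵐ = mon Sign.- 5 4

cfᵐ : ℕ → Mono
cfᵐ 0 = 0ᵐ
cfᵐ 1 = mon Sign.+ 0 0
cfᵐ 2 = mon Sign.- 1 1
cfᵐ 3 = mon Sign.- 3 3
cfᵐ 4 = mon Sign.+ 6 5
cfᵐ 5 = mon Sign.+ 10 8
cfᵐ (suc (suc (suc (suc (suc (suc s)))))) = tᵐ · wᵐ ^ᵐ s · cfᵐ s

module ClosedForm (α : ℤ) where

  open Evaluation α (α + 1ℤ) public

  t w : ℤ
  t = ⟦ tᵐ ⟧
  w = ⟦ wᵐ ⟧

  cf : ℕ → ℤ
  cf n = ⟦ cfᵐ n ⟧

  cf-step : ∀ s → cf (6 ℕ.+ s) ≡ t * w ^ s * cf s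
  cf-step s = trans (⟦·⟧ (tᵐ · wᵐ ^ᵐ s) (cfᵐ s))
                    (cong (_* cf s) (trans (⟦·⟧ tᵐ (wᵐ ^ᵐ s)) (cong (t *_) (⟦^⟧ wᵐ s))))

  t²≡w⁶ : t ^ 2 ≡ w ^ 6
  t²≡w⁶ = trans (sym (⟦^⟧ tᵐ 2)) (⟦^⟧ wᵐ 6)

  Z Y : ℕ → ℤ
  Z K = t ^ (K ℕ.* K)
  Y K = w ^ K

  private
    step-multiplier : ∀ K s c → t * w ^ (K ℕ.* 6 ℕ.+ s) * (Z K * Y K ^ s * c) ≡ Z (suc K) * Y (suc K) ^ s * c
    step-multiplier K s c = begin
      t * w ^ (K ℕ.* 6 ℕ.+ s) * (Z K * Y K ^ s * c)
        ≡⟨ cong (λ x → t * x * (Z K * Y K ^ s * c)) w-split ⟩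
      t * (t ^ (2 ℕ.* K) * w ^ s) * (Z K * Y K ^ s * c)
        ≡⟨ regroup t (t ^ (2 ℕ.* K)) (w ^ s) (Z K) (Y K ^ s) c ⟩
      t * (t ^ (2 ℕ.* K) * Z K) * (w ^ s * Y K ^ s) * c
        ≡⟨ cong₂ (λ x y → x * y * c) t-merge (sym (^-distrib-* w (Y K) s)) ⟩
      Z (suc K) * Y (suc K) ^ s * c ∎
      where
      open ≡-Reasoning
      regroup : ∀ t T W Z V c → t * (T * W) * (Z * V * c) ≡ t * (T * Z) * (W * V) * c
      regroup = solve-∀
      w-split : w ^ (K ℕ.* 6 ℕ.+ s) ≡ t ^ (2 ℕ.* K) * w ^ s
      w-split = begin
        w ^ (K ℕ.* 6 ℕ.+ s)     ≡⟨ ℤP.^-distribˡ-+-* w (K ℕ.* 6) s ⟩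
        w ^ (K ℕ.* 6) * w ^ s   ≡⟨ cong (λ e → w ^ e * w ^ s) (ℕP.*-comm K 6) ⟩
        w ^ (6 ℕ.* K) * w ^ s   ≡⟨ cong (_* w ^ s) (sym (ℤP.^-*-assoc w 6 K)) ⟩
        (w ^ 6) ^ K * w ^ s     ≡⟨ cong (λ x → x ^ K * w ^ s) (sym t²≡w⁶) ⟩
        (t ^ 2) ^ K * w ^ s     ≡⟨ cong (_* w ^ s) (ℤP.^-*-assoc t 2 K) ⟩
        t ^ (2 ℕ.* K) * w ^ s   ∎
      square-succ : ∀ K → suc K ℕ.* suc K ≡ suc (2 ℕ.* K ℕ.+ K ℕ.* K)
      square-succ = ℕSolver.solve-∀
      t-merge : t * (t ^ (2 ℕ.* K) * Z K) ≡ Z (suc K)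
      t-merge = trans (cong (t *_) (sym (ℤP.^-distribˡ-+-* t (2 ℕ.* K) (K ℕ.* K))))
                      (cong (t ^_) (sym (square-succ K)))

  quasi-periodic : ∀ K s → cf (K ℕ.* 6 ℕ.+ s) ≡ Z K * Y K ^ s * cf s
  quasi-periodic zero    s = sym (trans (cong (λ x → 1ℤ * x * cf s) (ℤP.^-zeroˡ s)) (ℤP.*-identityˡ (cf s)))
  quasi-periodic (suc K) s = begin
    cf (suc K ℕ.* 6 ℕ.+ s)                       ≡⟨ cf-step (K ℕ.* 6 ℕ.+ s) ⟩
    t * w ^ (K ℕ.* 6 ℕ.+ s) * cf (K ℕ.* 6 ℕ.+ s)  ≡⟨ cong (t * w ^ (K ℕ.* 6 ℕ.+ s) *_) (quasi-periodic K s) ⟩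
    t * w ^ (K ℕ.* 6 ℕ.+ s) * (Z K * Y K ^ s * cf s) ≡⟨ step-multiplier K s (cf s) ⟩
    Z (suc K) * Y (suc K) ^ s * cf s              ∎
    where open ≡-Reasoning

  quasi-periodic-double : ∀ K s → cf ((K ℕ.+ K) ℕ.* 6 ℕ.+ s) ≡ Z K ^ 4 * (Y K ^ 2) ^ s * cf s
  quasi-periodic-double K s = trans (quasi-periodic (K ℕ.+ K) s) (cong₂ (λ x y → x * y ^ s * cf s) Z-double Y-double)
    where
    double-square : ∀ K → (K ℕ.+ K) ℕ.* (K ℕ.+ K) ≡ K ℕ.* K ℕ.* 4
    double-square = ℕSolver.solve-∀
    double : ∀ K → K ℕ.+ K ≡ K ℕ.* 2
    double = ℕSolver.solve-∀
    Z-double : Z (K ℕ.+ K) ≡ Z K ^ 4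
    Z-double = trans (cong (t ^_) (double-square K)) (sym (ℤP.^-*-assoc t (K ℕ.* K) 4))
    Y-double : Y (K ℕ.+ K) ≡ Y K ^ 2
    Y-double = trans (cong (w ^_) (double K)) (sym (ℤP.^-*-assoc w K 2))

  power-multiplier : ∀ e q s → cf (e ℕ.* q ℕ.* 6 ℕ.+ s) ≡ (t ^ (q ℕ.* q ℕ.* e) * Y q ^ s) ^ e * cf s
  power-multiplier e q s = begin
    cf (e ℕ.* q ℕ.* 6 ℕ.+ s)                     ≡⟨ quasi-periodic (e ℕ.* q) s ⟩
    Z (e ℕ.* q) * Y (e ℕ.* q) ^ s * cf s          ≡⟨ cong₂ (λ x y → x * y * cf s) Z-power Y-power ⟩
    (t ^ (q ℕ.* q ℕ.* e)) ^ e * (Y q ^ s) ^ e * cf s ≡⟨ cong (_* cf s) (sym (^-distrib-* _ _ e)) ⟩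
    (t ^ (q ℕ.* q ℕ.* e) * Y q ^ s) ^ e * cf s    ∎
    where
    open ≡-Reasoning
    square-exponent : ∀ e q → e ℕ.* q ℕ.* (e ℕ.* q) ≡ q ℕ.* q ℕ.* e ℕ.* e
    square-exponent = ℕSolver.solve-∀
    linear-exponent : ∀ e q s → e ℕ.* q ℕ.* s ≡ q ℕ.* (s ℕ.* e)
    linear-exponent = ℕSolver.solve-∀
    Z-power : Z (e ℕ.* q) ≡ (t ^ (q ℕ.* q ℕ.* e)) ^ e
    Z-power = trans (cong (t ^_) (square-exponent e q)) (sym (ℤP.^-*-assoc t (q ℕ.* q ℕ.* e) e))
    Y-power : Y (e ℕ.* q) ^ s ≡ (Y q ^ s) ^ e
    Y-power = begin
      (w ^ (e ℕ.* q)) ^ s       ≡⟨ ℤP.^-*-assoc w (e ℕ.* q) s ⟩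
      w ^ (e ℕ.* q ℕ.* s)       ≡⟨ cong (w ^_) (linear-exponent e q s) ⟩
      w ^ (q ℕ.* (s ℕ.* e))     ≡⟨ sym (ℤP.^-*-assoc w q (s ℕ.* e)) ⟩
      (w ^ q) ^ (s ℕ.* e)       ≡⟨ sym (ℤP.^-*-assoc (w ^ q) s e) ⟩
      ((w ^ q) ^ s) ^ e         ∎

-- The two duplication formulas defining the sequence: h_{2m+1} = oddAt h m
-- and h₂ · h_{2m} = evenAt h m.
oddRule : ℤ → ℤ → ℤ → ℤ → ℤ
oddRule p q r s = p * q ^ 3 - r * s ^ 3

evenRule : ℤ → ℤ → ℤ → ℤ → ℤ → ℤ
evenRule p q r s u = p * (q * r ^ 2 - s * u ^ 2)

oddAt : (ℕ → ℤ) → ℕ → ℤ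
oddAt h m = oddRule (h (m ℕ.+ 2)) (h m) (h (m ∸ 1)) (h (m ℕ.+ 1))

evenAt : (ℕ → ℤ) → ℕ → ℤ
evenAt h m = evenRule (h m) (h (m ℕ.+ 2)) (h (m ∸ 1)) (h (m ∸ 2)) (h (m ℕ.+ 1))

oddRule-cong : ∀ {p p′ q q′ r r′ s s′} → p ≡ p′ → q ≡ q′ → r ≡ r′ → s ≡ s′ →
               oddRule p q r s ≡ oddRule p′ q′ r′ s′
oddRule-cong refl refl refl refl = refl

evenRule-cong : ∀ {p p′ q q′ r r′ s s′ u u′} → p ≡ p′ → q ≡ q′ → r ≡ r′ → s ≡ s′ → u ≡ u′ →
                evenRule p q r s u ≡ evenRule p′ q′ r′ s′ u′
evenRule-cong refl refl refl refl refl = refl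

private
  below-m+2 : ∀ m d → m ∸ d ≤ m ℕ.+ 2
  below-m+2 m d = ℕP.≤-trans (ℕP.m∸n≤m m d) (ℕP.m≤m+n m 2)

oddAt-local : ∀ h h′ m → (∀ i → i ≤ m ℕ.+ 2 → h i ≡ h′ i) → oddAt h m ≡ oddAt h′ m
oddAt-local h h′ m agree =
  oddRule-cong (agree (m ℕ.+ 2) ℕP.≤-refl) (agree m (ℕP.m≤m+n m 2))
               (agree (m ∸ 1) (below-m+2 m 1)) (agree (m ℕ.+ 1) (ℕP.+-monoʳ-≤ m (s≤s z≤n)))

evenAt-local : ∀ h h′ m → (∀ i → i ≤ m ℕ.+ 2 → h i ≡ h′ i) → evenAt h m ≡ evenAt h′ m
evenAt-local h h′ m agree =
  evenRule-cong (agree m (ℕP.m≤m+n m 2)) (agree (m ℕ.+ 2) ℕP.≤-refl) (agree (m ∸ 1) (below-m+2 m 1))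
                (agree (m ∸ 2) (below-m+2 m 2)) (agree (m ℕ.+ 1) (ℕP.+-monoʳ-≤ m (s≤s z≤n)))

oddAt-shift : ∀ h c m → 1 ≤ m → oddAt (λ s → h (c ℕ.+ s)) m ≡ oddAt h (c ℕ.+ m)
oddAt-shift h c m 1≤m = oddRule-cong (cong h (sym (ℕP.+-assoc c m 2))) (refl {x = h (c ℕ.+ m)})
                                     (cong h (sym (ℕP.+-∸-assoc c 1≤m))) (cong h (sym (ℕP.+-assoc c m 1)))

evenAt-shift : ∀ h c m → 2 ≤ m → evenAt (λ s → h (c ℕ.+ s)) m ≡ evenAt h (c ℕ.+ m)
evenAt-shift h c m 2≤m = evenRule-cong (refl {x = h (c ℕ.+ m)}) (cong h (sym (ℕP.+-assoc c m 2)))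
                                       (cong h (sym (ℕP.+-∸-assoc c (ℕP.≤-trans (s≤s z≤n) 2≤m))))
                                       (cong h (sym (ℕP.+-∸-assoc c 2≤m))) (cong h (sym (ℕP.+-assoc c m 1)))

scaled : ℤ → ℤ → (ℕ → ℤ) → ℕ → ℤ
scaled Z Y v s = Z * Y ^ s * v s

private
  pow-at : ∀ Y {n} j k → n ≡ j ℕ.+ k → Y ^ n ≡ Y ^ j * Y ^ k
  pow-at Y j k refl = ℤP.^-distribˡ-+-* Y j k

  square-pow-at : ∀ Y {n} j k → 2 ℕ.* n ≡ j ℕ.* 4 ℕ.+ k → (Y ^ 2) ^ n ≡ (Y ^ j) ^ 4 * Y ^ k
  square-pow-at Y {n} j k eq = begin
    (Y ^ 2) ^ n           ≡⟨ ℤP.^-*-assoc Y 2 n ⟩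
    Y ^ (2 ℕ.* n)         ≡⟨ pow-at Y (j ℕ.* 4) k eq ⟩
    Y ^ (j ℕ.* 4) * Y ^ k ≡⟨ cong (_* Y ^ k) (sym (ℤP.^-*-assoc Y j 4)) ⟩
    (Y ^ j) ^ 4 * Y ^ k   ∎
    where open ≡-Reasoning

  swap-summand : ∀ i j k → i ℕ.+ j ℕ.+ k ≡ j ℕ.+ (i ℕ.+ k)
  swap-summand = ℕSolver.solve-∀

  -- The two homogeneity identities, with powers written out for the ring solver.
  odd-homogeneity : ∀ Z P Y p q r s →
    oddRule (Z * (P * Y ^ 3) * p) (Z * (P * Y ^ 1) * q) (Z * P * r) (Z * (P * Y ^ 2) * s)
      ≡ Z ^ 4 * (P ^ 4 * Y ^ 6) * oddRule p q r s
  odd-homogeneity = solved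
    where
    solved : ∀ Z P Y p q r s →
      Z * (P * (Y * (Y * (Y * 1ℤ)))) * p * ((Z * (P * (Y * 1ℤ)) * q) * ((Z * (P * (Y * 1ℤ)) * q) * ((Z * (P * (Y * 1ℤ)) * q) * 1ℤ)))
        - Z * P * r * ((Z * (P * (Y * (Y * 1ℤ))) * s) * ((Z * (P * (Y * (Y * 1ℤ))) * s) * ((Z * (P * (Y * (Y * 1ℤ))) * s) * 1ℤ)))
      ≡ Z * (Z * (Z * (Z * 1ℤ))) * (P * (P * (P * (P * 1ℤ))) * (Y * (Y * (Y * (Y * (Y * (Y * 1ℤ)))))))
        * (p * (q * (q * (q * 1ℤ))) - r * (s * (s * (s * 1ℤ))))
    solved = solve-∀

  even-homogeneity : ∀ Z P Y p q r s u →
    evenRule (Z * (P * Y ^ 2) * p) (Z * (P * Y ^ 4) * q) (Z * (P * Y ^ 1) * r) (Z * P * s) (Z * (P * Y ^ 3) * u)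
      ≡ Z ^ 4 * (P ^ 4 * Y ^ 8) * evenRule p q r s u
  even-homogeneity = solved
    where
    solved : ∀ Z P Y p q r s u →
      Z * (P * (Y * (Y * 1ℤ))) * p
        * (Z * (P * (Y * (Y * (Y * (Y * 1ℤ))))) * q * ((Z * (P * (Y * 1ℤ)) * r) * ((Z * (P * (Y * 1ℤ)) * r) * 1ℤ))
           - Z * P * s * ((Z * (P * (Y * (Y * (Y * 1ℤ)))) * u) * ((Z * (P * (Y * (Y * (Y * 1ℤ)))) * u) * 1ℤ)))
      ≡ Z * (Z * (Z * (Z * 1ℤ))) * (P * (P * (P * (P * 1ℤ))) * (Y * (Y * (Y * (Y * (Y * (Y * (Y * (Y * 1ℤ)))))))))
        * (p * (q * (r * (r * 1ℤ)) - s * (u * (u * 1ℤ))))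
    solved = solve-∀

oddAt-scaled : ∀ Z Y v j →
  oddAt (scaled Z Y v) (suc j) ≡ Z ^ 4 * (Y ^ 2) ^ suc (suc j ℕ.+ suc j) * oddAt v (suc j)
oddAt-scaled Z Y v j = begin
  oddAt (scaled Z Y v) (suc j)
    ≡⟨ oddRule-cong (cong (λ x → Z * x * v (suc j ℕ.+ 2)) (pow-at Y j 3 (swap-summand 1 j 2)))
                    (cong (λ x → Z * x * v (suc j)) (pow-at Y j 1 (ℕP.+-comm 1 j)))
                    (refl {x = Z * Y ^ j * v j}) (cong (λ x → Z * x * v (suc j ℕ.+ 1)) (pow-at Y j 2 (swap-summand 1 j 1))) ⟩
  oddRule (Z * (Y ^ j * Y ^ 3) * v (suc j ℕ.+ 2)) (Z * (Y ^ j * Y ^ 1) * v (suc j))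
          (Z * Y ^ j * v j) (Z * (Y ^ j * Y ^ 2) * v (suc j ℕ.+ 1))
    ≡⟨ odd-homogeneity Z (Y ^ j) Y (v (suc j ℕ.+ 2)) (v (suc j)) (v j) (v (suc j ℕ.+ 1)) ⟩
  Z ^ 4 * ((Y ^ j) ^ 4 * Y ^ 6) * oddAt v (suc j)
    ≡⟨ cong (λ x → Z ^ 4 * x * oddAt v (suc j)) (sym (square-pow-at Y j 6 (exponent j))) ⟩
  Z ^ 4 * (Y ^ 2) ^ suc (suc j ℕ.+ suc j) * oddAt v (suc j) ∎
  where
  open ≡-Reasoning
  exponent : ∀ j → 2 ℕ.* suc (suc j ℕ.+ suc j) ≡ j ℕ.* 4 ℕ.+ 6
  exponent = ℕSolver.solve-∀

evenAt-scaled : ∀ Z Y v j →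
  evenAt (scaled Z Y v) (2 ℕ.+ j) ≡ Z ^ 4 * (Y ^ 2) ^ ((2 ℕ.+ j) ℕ.+ (2 ℕ.+ j)) * evenAt v (2 ℕ.+ j)
evenAt-scaled Z Y v j = begin
  evenAt (scaled Z Y v) (2 ℕ.+ j)
    ≡⟨ evenRule-cong (cong (λ x → Z * x * v m) (pow-at Y j 2 (ℕP.+-comm 2 j)))
                     (cong (λ x → Z * x * v (m ℕ.+ 2)) (pow-at Y j 4 (swap-summand 2 j 2)))
                     (cong (λ x → Z * x * v (suc j)) (pow-at Y j 1 (ℕP.+-comm 1 j)))
                     (refl {x = Z * Y ^ j * v j}) (cong (λ x → Z * x * v (m ℕ.+ 1)) (pow-at Y j 3 (swap-summand 2 j 1))) ⟩
  evenRule (Z * (Y ^ j * Y ^ 2) * v m) (Z * (Y ^ j * Y ^ 4) * v (m ℕ.+ 2)) (Z * (Y ^ j * Y ^ 1) * v (suc j))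
           (Z * Y ^ j * v j) (Z * (Y ^ j * Y ^ 3) * v (m ℕ.+ 1))
    ≡⟨ even-homogeneity Z (Y ^ j) Y (v m) (v (m ℕ.+ 2)) (v (suc j)) (v j) (v (m ℕ.+ 1)) ⟩
  Z ^ 4 * ((Y ^ j) ^ 4 * Y ^ 8) * evenAt v (2 ℕ.+ j)
    ≡⟨ cong (λ x → Z ^ 4 * x * evenAt v (2 ℕ.+ j)) (sym (square-pow-at Y j 8 (exponent j))) ⟩
  Z ^ 4 * (Y ^ 2) ^ ((2 ℕ.+ j) ℕ.+ (2 ℕ.+ j)) * evenAt v (2 ℕ.+ j) ∎
  where
  open ≡-Reasoning
  m = 2 ℕ.+ j
  exponent : ∀ j → 2 ℕ.* ((2 ℕ.+ j) ℕ.+ (2 ℕ.+ j)) ≡ j ℕ.* 4 ℕ.+ 8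
  exponent = ℕSolver.solve-∀

divide-by-6 : ∀ m d → d ≤ m → ∃₂ λ K r → r < 6 × m ≡ K ℕ.* 6 ℕ.+ (d ℕ.+ r)
divide-by-6 m d d≤m = K , r , ℕD.m%n<n (m ∸ d) 6 , (begin
  m                         ≡⟨ sym (ℕP.m+[n∸m]≡n d≤m) ⟩
  d ℕ.+ (m ∸ d)             ≡⟨ cong (d ℕ.+_) (ℕD.m≡m%n+[m/n]*n (m ∸ d) 6) ⟩
  d ℕ.+ (r ℕ.+ K ℕ.* 6)     ≡⟨ rearrange d r K ⟩
  K ℕ.* 6 ℕ.+ (d ℕ.+ r)     ∎)
  where
  open ≡-Reasoning
  K = (m ∸ d) ℕD./ 6
  r = (m ∸ d) ℕD.% 6
  rearrange : ∀ d r K → d ℕ.+ (r ℕ.+ K ℕ.* 6) ≡ K ℕ.* 6 ℕ.+ (d ℕ.+ r)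
  rearrange = ℕSolver.solve-∀

module Recurrences (α : ℤ) where

  open ClosedForm α

  private
    mono-product : ∀ m n k → ⟦ m ⟧ * ⟦ n ⟧ ^ k ≡ ⟦ m · n ^ᵐ k ⟧
    mono-product m n k = sym (trans (⟦·⟧ m (n ^ᵐ k)) (cong (⟦ m ⟧ *_) (⟦^⟧ n k)))

    odd-base-from : ∀ m → cfᵐ (m ℕ.+ 2) · cfᵐ m ^ᵐ 3 ─ cfᵐ (m ∸ 1) · cfᵐ (m ℕ.+ 1) ^ᵐ 3 ≐ cfᵐ (suc (m ℕ.+ m)) →
                    oddAt cf m ≡ cf (suc (m ℕ.+ m))
    odd-base-from m diff =
      trans (cong₂ _-_ (mono-product (cfᵐ (m ℕ.+ 2)) (cfᵐ m) 3) (mono-product (cfᵐ (m ∸ 1)) (cfᵐ (m ℕ.+ 1)) 3))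
            (⟦─⟧ refl diff)

    even-base-from : ∀ m {d} → cfᵐ (m ℕ.+ 2) · cfᵐ (m ∸ 1) ^ᵐ 2 ─ cfᵐ (m ∸ 2) · cfᵐ (m ℕ.+ 1) ^ᵐ 2 ≐ d →
                     cfᵐ m · d ≡ cfᵐ 2 · cfᵐ (m ℕ.+ m) → evenAt cf m ≡ cf 2 * cf (m ℕ.+ m)
    even-base-from m {d} diff product = begin
      cf m * (cf (m ℕ.+ 2) * cf (m ∸ 1) ^ 2 - cf (m ∸ 2) * cf (m ℕ.+ 1) ^ 2)
        ≡⟨ cong (cf m *_) (trans (cong₂ _-_ (mono-product (cfᵐ (m ℕ.+ 2)) (cfᵐ (m ∸ 1)) 2)
                                            (mono-product (cfᵐ (m ∸ 2)) (cfᵐ (m ℕ.+ 1)) 2))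
                                 (⟦─⟧ refl diff)) ⟩
      cf m * ⟦ d ⟧                     ≡⟨ sym (⟦·⟧ (cfᵐ m) d) ⟩
      ⟦ cfᵐ m · d ⟧                    ≡⟨ cong ⟦_⟧ product ⟩
      ⟦ cfᵐ 2 · cfᵐ (m ℕ.+ m) ⟧        ≡⟨ ⟦·⟧ (cfᵐ 2) (cfᵐ (m ℕ.+ m)) ⟩
      cf 2 * cf (m ℕ.+ m)              ∎
      where open ≡-Reasoning

    odd-base : ∀ r → r < 6 → oddAt cf (2 ℕ.+ r) ≡ cf (suc ((2 ℕ.+ r) ℕ.+ (2 ℕ.+ r)))
    odd-base 0 _ = odd-base-from 2 1-minus-b
    odd-base 1 _ = odd-base-from 3 b-minus-1
    odd-base 2 _ = odd-base-from 4 zero-minus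
    odd-base 3 _ = odd-base-from 5 minus-zero
    odd-base 4 _ = odd-base-from 6 zero-minus
    odd-base 5 _ = odd-base-from 7 minus-zero
    odd-base (suc (suc (suc (suc (suc (suc _)))))) (s≤s (s≤s (s≤s (s≤s (s≤s (s≤s ()))))))

    even-base : ∀ r → r < 6 → evenAt cf (3 ℕ.+ r) ≡ cf 2 * cf ((3 ℕ.+ r) ℕ.+ (3 ℕ.+ r))
    even-base 0 _ = even-base-from 3 self refl
    even-base 1 _ = even-base-from 4 zero-minus refl
    even-base 2 _ = even-base-from 5 minus-zero refl
    even-base 3 _ = sym (ℤP.*-zeroʳ (cf 2))   -- h₆ = h₁₂ = 0
    even-base 4 _ = even-base-from 7 zero-minus refl
    even-base 5 _ = even-base-from 8 minus-zero refl
    even-base (suc (suc (suc (suc (suc (suc _)))))) (s≤s (s≤s (s≤s (s≤s (s≤s (s≤s ()))))))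

  -- The closed form satisfies both duplication formulas: write m = 6K + m₀
  -- with m₀ a base index; quasi-periodicity turns the formula at m into the
  -- one at m₀ times Z_K⁴ · Y_K^{2k}, which quasi-periodicity at 2K absorbs.
  cf-odd : ∀ m → 2 ≤ m → oddAt cf m ≡ cf (suc (m ℕ.+ m))
  cf-odd m 2≤m with divide-by-6 m 2 2≤m
  ... | K , r , r<6 , refl = begin
    oddAt cf (K ℕ.* 6 ℕ.+ (2 ℕ.+ r))            ≡⟨ sym (oddAt-shift cf (K ℕ.* 6) (2 ℕ.+ r) (s≤s z≤n)) ⟩
    oddAt (λ s → cf (K ℕ.* 6 ℕ.+ s)) (2 ℕ.+ r)  ≡⟨ oddAt-local _ _ (2 ℕ.+ r) (λ s _ → quasi-periodic K s) ⟩
    oddAt (scaled (Z K) (Y K) cf) (2 ℕ.+ r)      ≡⟨ oddAt-scaled (Z K) (Y K) cf (1 ℕ.+ r) ⟩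
    Z K ^ 4 * (Y K ^ 2) ^ k * oddAt cf (2 ℕ.+ r) ≡⟨ cong (Z K ^ 4 * (Y K ^ 2) ^ k *_) (odd-base r r<6) ⟩
    Z K ^ 4 * (Y K ^ 2) ^ k * cf k               ≡⟨ sym (quasi-periodic-double K k) ⟩
    cf ((K ℕ.+ K) ℕ.* 6 ℕ.+ k)                   ≡⟨ cong cf (index K r) ⟩
    cf (suc (K ℕ.* 6 ℕ.+ (2 ℕ.+ r) ℕ.+ (K ℕ.* 6 ℕ.+ (2 ℕ.+ r)))) ∎
    where
    open ≡-Reasoning
    k = suc ((2 ℕ.+ r) ℕ.+ (2 ℕ.+ r))
    index : ∀ K r → (K ℕ.+ K) ℕ.* 6 ℕ.+ suc ((2 ℕ.+ r) ℕ.+ (2 ℕ.+ r))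
                    ≡ suc (K ℕ.* 6 ℕ.+ (2 ℕ.+ r) ℕ.+ (K ℕ.* 6 ℕ.+ (2 ℕ.+ r)))
    index = ℕSolver.solve-∀

  cf-even : ∀ m → 3 ≤ m → evenAt cf m ≡ cf 2 * cf (m ℕ.+ m)
  cf-even m 3≤m with divide-by-6 m 3 3≤m
  ... | K , r , r<6 , refl = begin
    evenAt cf (K ℕ.* 6 ℕ.+ (3 ℕ.+ r))            ≡⟨ sym (evenAt-shift cf (K ℕ.* 6) (3 ℕ.+ r) (s≤s (s≤s z≤n))) ⟩
    evenAt (λ s → cf (K ℕ.* 6 ℕ.+ s)) (3 ℕ.+ r)  ≡⟨ evenAt-local _ _ (3 ℕ.+ r) (λ s _ → quasi-periodic K s) ⟩
    evenAt (scaled (Z K) (Y K) cf) (3 ℕ.+ r)      ≡⟨ evenAt-scaled (Z K) (Y K) cf (1 ℕ.+ r) ⟩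
    Z K ^ 4 * (Y K ^ 2) ^ k * evenAt cf (3 ℕ.+ r) ≡⟨ cong (Z K ^ 4 * (Y K ^ 2) ^ k *_) (even-base r r<6) ⟩
    Z K ^ 4 * (Y K ^ 2) ^ k * (cf 2 * cf k)       ≡⟨ swap-front (Z K ^ 4 * (Y K ^ 2) ^ k) (cf 2) (cf k) ⟩
    cf 2 * (Z K ^ 4 * (Y K ^ 2) ^ k * cf k)       ≡⟨ cong (cf 2 *_) (sym (quasi-periodic-double K k)) ⟩
    cf 2 * cf ((K ℕ.+ K) ℕ.* 6 ℕ.+ k)             ≡⟨ cong (λ i → cf 2 * cf i) (index K r) ⟩
    cf 2 * cf (K ℕ.* 6 ℕ.+ (3 ℕ.+ r) ℕ.+ (K ℕ.* 6 ℕ.+ (3 ℕ.+ r))) ∎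
    where
    open ≡-Reasoning
    k = (3 ℕ.+ r) ℕ.+ (3 ℕ.+ r)
    swap-front : ∀ x y z → x * (y * z) ≡ y * (x * z)
    swap-front = solve-∀
    index : ∀ K r → (K ℕ.+ K) ℕ.* 6 ℕ.+ ((3 ℕ.+ r) ℕ.+ (3 ℕ.+ r))
                    ≡ K ℕ.* 6 ℕ.+ (3 ℕ.+ r) ℕ.+ (K ℕ.* 6 ℕ.+ (3 ℕ.+ r))
    index = ℕSolver.solve-∀

multiple-below : ∀ {r} k n → r ≡ k ℕ.* n → r < n → k ≡ 0
multiple-below zero    n _    _   = refl
multiple-below (suc k) n refl r<n = ⊥-elim (ℕP.<⇒≱ r<n (ℕP.m≤m+n n (k ℕ.* n)))

divℤ-exact : ∀ c y → c ≢ 0ℤ → divℤ (c * y) c ≡ y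
divℤ-exact c y c≢0 with c ℤ.≟ 0ℤ
... | yes c≡0 = ⊥-elim (c≢0 c≡0)
... | no c≢0′ = sym (ℤP.i-j≡0⇒i≡j y q (ℤP.∣i∣≡0⇒i≡0 (multiple-below ℤ.∣ y - q ∣ ℤ.∣ c ∣ r≡ (ℤD.n%d<d (c * y) c))))
  where
  instance _ = ≢-nonZero c≢0′
  q = (c * y) ℤD./ c
  r = (c * y) ℤD.% c
  remainder : ∀ c y r q → c * y ≡ + r + q * c → + r ≡ (y - q) * c
  remainder c y r q eq = trans (sym (cancel (+ r) q c)) (trans (cong (_- q * c) (sym eq)) (factor c y q))
    where
    cancel : ∀ r q c → r + q * c - q * c ≡ r
    cancel = solve-∀
    factor : ∀ c y q → c * y - q * c ≡ (y - q) * c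
    factor = solve-∀
  r≡ : r ≡ ℤ.∣ y - q ∣ ℕ.* ℤ.∣ c ∣
  r≡ = trans (cong ℤ.∣_∣ (remainder c y r q (ℤD.a≡a%n+[a/n]*n (c * y) c))) (ℤP.abs-* (y - q) c)

private
  mod-step : ∀ n → suc (suc n) % 2 ≡ n % 2
  mod-step n = trans (cong (_% 2) (ℕP.+-comm 2 n)) (ℕD.[m+n]%n≡m%n n 2)

parity : ∀ n → (n % 2 ≡ 0 × n ≡ ⌊ n /2⌋ ℕ.+ ⌊ n /2⌋) ⊎ (n % 2 ≡ 1 × n ≡ suc (⌊ n /2⌋ ℕ.+ ⌊ n /2⌋))
parity zero          = inj₁ (refl , refl)
parity (suc zero)    = inj₂ (refl , refl)
parity (suc (suc n)) with parity n
... | inj₁ (p , e) = inj₁ (trans (mod-step n) p , cong suc (trans (cong suc e) (sym (ℕP.+-suc _ _))))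
... | inj₂ (p , e) = inj₂ (trans (mod-step n) p , cong (λ k → suc (suc k)) (trans e (sym (ℕP.+-suc _ _))))

module _ (α : ℤ) (f n′ : ℕ) where

  private
    n = 5 ℕ.+ n′

  hf-even : n % 2 ≡ 0 → hf α (suc f) n ≡ divℤ (evenAt (hf α f) ⌊ n /2⌋) (- (α * (α + 1ℤ)))
  hf-even p with n % 2 | p
  ... | .0 | refl = refl

  hf-odd : n % 2 ≡ 1 → hf α (suc f) n ≡ oddAt (hf α f) ⌊ n /2⌋
  hf-odd p with n % 2 | p
  ... | .1 | refl = refl

private
  three≤half : ∀ n′ m → 5 ℕ.+ n′ ≡ m ℕ.+ m → 3 ≤ m
  three≤half n′ (suc (suc (suc m))) _ = s≤s (s≤s (s≤s z≤n))

  two≤half : ∀ n′ m → 5 ℕ.+ n′ ≡ suc (m ℕ.+ m) → 2 ≤ m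
  two≤half n′ (suc (suc m)) _ = s≤s (s≤s z≤n)

module SequenceIsClosedForm (α : ℤ) (α≢0 : α ≢ 0ℤ) (α≢-1 : α ≢ -1ℤ) where

  open ClosedForm α
  open Recurrences α

  private
    h₂ : ℤ
    h₂ = - (α * (α + 1ℤ))

    h₂≡cf₂ : h₂ ≡ cf 2
    h₂≡cf₂ = cong -_ (cong₂ _*_ (sym (ℤP.*-identityʳ α)) (sym (ℤP.*-identityʳ (α + 1ℤ))))

    h₂≢0 : h₂ ≢ 0ℤ
    h₂≢0 rewrite h₂≡cf₂ = mon≢0 α≢0 (+1≢0 α≢-1) Sign.- 1 1

  -- By induction on the fuel: the terms used at n ≥ 5 have index at most
  -- ⌊n/2⌋ + 2 < n, where the sequence already agrees with cf.
  hf≡cf : ∀ f n → n ≤ f → hf α f n ≡ cf n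
  agree : ∀ {f b} → b ≤ f → ∀ i → i ≤ b → hf α f i ≡ cf i
  agree {f} b≤f i i≤b = hf≡cf f i (ℕP.≤-trans i≤b b≤f)

  hf≡cf zero    zero z≤n = refl
  hf≡cf (suc f) 0 _ = refl
  hf≡cf (suc f) 1 _ = refl
  hf≡cf (suc f) 2 _ = h₂≡cf₂
  hf≡cf (suc f) 3 _ = refl
  hf≡cf (suc f) 4 _ = refl
  hf≡cf (suc f) n@(suc (suc (suc (suc (suc n′))))) n≤1+f with parity n
  ... | inj₁ (even , n≡m+m) = begin
    hf α (suc f) n                   ≡⟨ hf-even α f n′ even ⟩
    divℤ (evenAt (hf α f) m) h₂      ≡⟨ cong (λ x → divℤ x h₂) (evenAt-local (hf α f) cf m (agree m+2≤f)) ⟩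
    divℤ (evenAt cf m) h₂            ≡⟨ cong (λ x → divℤ x h₂) (cf-even m (three≤half n′ m n≡m+m)) ⟩
    divℤ (cf 2 * cf (m ℕ.+ m)) h₂    ≡⟨ cong (λ c → divℤ (c * cf (m ℕ.+ m)) h₂) (sym h₂≡cf₂) ⟩
    divℤ (h₂ * cf (m ℕ.+ m)) h₂      ≡⟨ divℤ-exact h₂ (cf (m ℕ.+ m)) h₂≢0 ⟩
    cf (m ℕ.+ m)                     ≡⟨ cong cf (sym n≡m+m) ⟩
    cf n                             ∎
    where
    open ≡-Reasoning
    m = ⌊ n /2⌋
    m+2≤f : m ℕ.+ 2 ≤ f
    m+2≤f = ℕP.≤-pred (ℕP.≤-trans (subst (m ℕ.+ 2 <_) (sym n≡m+m) (ℕP.+-monoʳ-< m (three≤half n′ m n≡m+m))) n≤1+f)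
  ... | inj₂ (odd , n≡1+m+m) = begin
    hf α (suc f) n         ≡⟨ hf-odd α f n′ odd ⟩
    oddAt (hf α f) m       ≡⟨ oddAt-local (hf α f) cf m (agree m+2≤f) ⟩
    oddAt cf m             ≡⟨ cf-odd m (two≤half n′ m n≡1+m+m) ⟩
    cf (suc (m ℕ.+ m))     ≡⟨ cong cf (sym n≡1+m+m) ⟩
    cf n                   ∎
    where
    open ≡-Reasoning
    m = ⌊ n /2⌋
    m+2≤f : m ℕ.+ 2 ≤ f
    m+2≤f = ℕP.≤-pred (ℕP.≤-trans (subst (m ℕ.+ 2 <_) (sym n≡1+m+m) (s≤s (ℕP.+-monoʳ-≤ m (two≤half n′ m n≡1+m+m)))) n≤1+f)

  hseq≡cf : ∀ n → hseq α n ≡ cf n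
  hseq≡cf n = hf≡cf n n ℕP.≤-refl

-- If yᵏ divides zᵏ (k ≥ 1) then y divides z: divide by d = gcd(y, z), so
-- that y/d is coprime to (z/d)ᵏ and divides it, hence y/d = 1.
^-cancel-∣ : ∀ k y z → y ℕ.^ suc k ℕ∣.∣ z ℕ.^ suc k → y ℕ∣.∣ z
^-cancel-∣ k zero z 0∣zᵏ =
  subst (0 ℕ∣.∣_) (sym (ℕP.m^n≡0⇒m≡0 z (suc k) (ℕ∣.0∣⇒≡0 0∣zᵏ))) ℕ∣.∣-refl
^-cancel-∣ k y@(suc _) z yᵏ∣zᵏ = subst (ℕ∣._∣ z) y′d≡y (subst (λ u → u ℕ.* d ℕ∣.∣ z) (sym y′≡1) d∣z)
  where
  d = gcd y z
  instance d≢0 : NonZero d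
           d≢0 = ℕ.≢-nonZero (gcd[m,n]≢0 y z (inj₁ (λ ())))
  instance dᵏ≢0 : NonZero (d ℕ.^ suc k)
           dᵏ≢0 = ℕP.m^n≢0 d (suc k)
  y′ = y ℕ./ d
  z′ = z ℕ./ d
  y′d≡y : y′ ℕ.* d ≡ y
  y′d≡y = ℕD.m/n*n≡m (gcd[m,n]∣m y z)
  z′d≡z : z′ ℕ.* d ≡ z
  z′d≡z = ℕD.m/n*n≡m (gcd[m,n]∣n y z)
  d∣z : 1 ℕ.* d ℕ∣.∣ z
  d∣z = subst (ℕ∣._∣ z) (sym (ℕP.*-identityˡ d)) (gcd[m,n]∣n y z)
  divides-scaled : y′ ℕ.^ suc k ℕ.* d ℕ.^ suc k ℕ∣.∣ z′ ℕ.^ suc k ℕ.* d ℕ.^ suc k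
  divides-scaled = subst₂ ℕ∣._∣_ (trans (cong (ℕ._^ suc k) (sym y′d≡y)) (ℕ-^-distrib-* y′ d (suc k)))
                         (trans (cong (ℕ._^ suc k) (sym z′d≡z)) (ℕ-^-distrib-* z′ d (suc k))) yᵏ∣zᵏ
  coprime-pow : ∀ {a b} → Coprime a b → ∀ j → a ℕ∣.∣ b ℕ.^ j → a ℕ∣.∣ 1
  coprime-pow c zero    a∣1    = a∣1
  coprime-pow c (suc j) a∣bᵏ⁺¹ = coprime-pow c j (coprime-divisor c a∣bᵏ⁺¹)
  y′≡1 : y′ ≡ 1
  y′≡1 = ℕ∣.∣1⇒≡1 (coprime-pow (coprime-/gcd y z) (suc k)
                     (ℕ∣.∣-trans (ℕ∣.m∣m*n (y′ ℕ.^ k)) (ℕ∣.*-cancelʳ-∣ (d ℕ.^ suc k) divides-scaled)))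

∣^∣ : ∀ x n → ℤ.∣ x ^ n ∣ ≡ ℤ.∣ x ∣ ℕ.^ n
∣^∣ x zero    = refl
∣^∣ x (suc n) = trans (ℤP.abs-* x (x ^ n)) (cong (ℤ.∣ x ∣ ℕ.*_) (∣^∣ x n))

root-divides : ∀ k Y β c → Y ^ suc k * c ≡ β ^ suc k → Y ℤ∣.∣ β
root-divides k Y β c eq = ∣ᵤ⇒∣ (^-cancel-∣ k ℤ.∣ Y ∣ ℤ.∣ β ∣ (ℕ∣.divides ℤ.∣ c ∣ abs-eq))
  where
  abs-eq : ℤ.∣ β ∣ ℕ.^ suc k ≡ ℤ.∣ c ∣ ℕ.* ℤ.∣ Y ∣ ℕ.^ suc k
  abs-eq = begin
    ℤ.∣ β ∣ ℕ.^ suc k               ≡⟨ sym (∣^∣ β (suc k)) ⟩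
    ℤ.∣ β ^ suc k ∣                  ≡⟨ cong ℤ.∣_∣ (sym eq) ⟩
    ℤ.∣ Y ^ suc k * c ∣              ≡⟨ ℤP.abs-* (Y ^ suc k) c ⟩
    ℤ.∣ Y ^ suc k ∣ ℕ.* ℤ.∣ c ∣      ≡⟨ cong (ℕ._* ℤ.∣ c ∣) (∣^∣ Y (suc k)) ⟩
    ℤ.∣ Y ∣ ℕ.^ suc k ℕ.* ℤ.∣ c ∣    ≡⟨ ℕP.*-comm (ℤ.∣ Y ∣ ℕ.^ suc k) ℤ.∣ c ∣ ⟩
    ℤ.∣ c ∣ ℕ.* ℤ.∣ Y ∣ ℕ.^ suc k    ∎
    where open ≡-Reasoning

private
  factor-≢0 : ∀ {β γ} Y → β ≢ 0ℤ → β ≡ γ * Y → γ ≢ 0ℤ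
  factor-≢0 Y β≢0 β≡γY refl = β≢0 β≡γY

square-cofactor : ∀ Y c β → Y ≢ 0ℤ → Y ^ 2 * c ≡ β * β → Σ ℤ λ γ → β ≡ γ * Y × c ≡ γ * γ
square-cofactor Y c β Y≢0 eq = γ , β≡γY ,
  ℤP.*-cancelˡ-≡ (Y ^ 2) c (γ * γ) (trans eq (trans (cong (λ x → x * x) β≡γY) (regroup γ Y)))
  where
  instance _ = ≢-nonZero (^-≢0 2 Y≢0)
  square : ∀ β → β * β ≡ β * (β * 1ℤ)
  square = solve-∀
  regroup : ∀ γ Y → γ * Y * (γ * Y) ≡ Y * (Y * 1ℤ) * (γ * γ)
  regroup = solve-∀
  Y∣β = root-divides 1 Y β c (trans eq (square β))
  γ = ℤ∣._∣_.quotient Y∣β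
  β≡γY = ℤ∣._∣_.equality Y∣β

cube-cofactor : ∀ Y c β → Y ≢ 0ℤ → Y ^ 3 * c ≡ β * β * β → Σ ℤ λ γ → β ≡ γ * Y × c ≡ γ * γ * γ
cube-cofactor Y c β Y≢0 eq = γ , β≡γY ,
  ℤP.*-cancelˡ-≡ (Y ^ 3) c (γ * γ * γ) (trans eq (trans (cong (λ x → x * x * x) β≡γY) (regroup γ Y)))
  where
  instance _ = ≢-nonZero (^-≢0 3 Y≢0)
  cube : ∀ β → β * β * β ≡ β * (β * (β * 1ℤ))
  cube = solve-∀
  regroup : ∀ γ Y → γ * Y * (γ * Y) * (γ * Y) ≡ Y * (Y * (Y * 1ℤ)) * (γ * γ * γ)
  regroup = solve-∀
  Y∣β = root-divides 2 Y β c (trans eq (cube β))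
  γ = ℤ∣._∣_.quotient Y∣β
  β≡γY = ℤ∣._∣_.equality Y∣β

square-factor : ∀ Y c → Y ≢ 0ℤ → IsSquare (Y ^ 2 * c) ⇔ IsSquare c
square-factor Y c Y≢0 = mk⇔ to from
  where
  negate : Y ^ 2 * - c ≡ - (Y ^ 2 * c)
  negate = sym (ℤP.neg-distribʳ-* (Y ^ 2) c)
  lift⁺ : ∀ β → Y ^ 2 * (β * β) ≡ Y * β * (Y * β)
  lift⁺ β = solved Y β
    where
    solved : ∀ Y β → Y * (Y * 1ℤ) * (β * β) ≡ Y * β * (Y * β)
    solved = solve-∀
  lift⁻ : ∀ β → Y ^ 2 * - (β * β) ≡ - (Y * β * (Y * β))
  lift⁻ β = trans (sym (ℤP.neg-distribʳ-* (Y ^ 2) (β * β))) (cong -_ (lift⁺ β))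
  to : IsSquare (Y ^ 2 * c) → IsSquare c
  to (β , β≢0 , inj₁ eq) = let (γ , β≡γY , c≡γ²) = square-cofactor Y c β Y≢0 eq in
    γ , factor-≢0 Y β≢0 β≡γY , inj₁ c≡γ²
  to (β , β≢0 , inj₂ eq) =
    let (γ , β≡γY , -c≡γ²) = square-cofactor Y (- c) β Y≢0 (trans negate (trans (cong -_ eq) (ℤP.neg-involutive (β * β)))) in
    γ , factor-≢0 Y β≢0 β≡γY , inj₂ (trans (sym (ℤP.neg-involutive c)) (cong -_ -c≡γ²))
  from : IsSquare c → IsSquare (Y ^ 2 * c)
  from (β , β≢0 , inj₁ eq) = Y * β , *-≢0 Y≢0 β≢0 , inj₁ (trans (cong (Y ^ 2 *_) eq) (lift⁺ β))
  from (β , β≢0 , inj₂ eq) = Y * β , *-≢0 Y≢0 β≢0 , inj₂ (trans (cong (Y ^ 2 *_) eq) (lift⁻ β))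

cube-factor : ∀ Y c → Y ≢ 0ℤ → c ≢ 0ℤ → IsCube (Y ^ 3 * c ^ 2) ⇔ IsCube c
cube-factor Y c Y≢0 c≢0 = mk⇔ to from
  where
  fourth-power : ∀ δ → c ^ 2 ≡ δ * δ * δ → c ^ 3 * c ≡ δ * δ * (δ * δ) * (δ * δ)
  fourth-power δ eq = trans (split c) (trans (cong (λ x → x * x) eq) (regroup δ))
    where
    split : ∀ c → c * (c * (c * 1ℤ)) * c ≡ c * (c * 1ℤ) * (c * (c * 1ℤ))
    split = solve-∀
    regroup : ∀ δ → δ * δ * δ * (δ * δ * δ) ≡ δ * δ * (δ * δ) * (δ * δ)
    regroup = solve-∀
  lift : ∀ β → Y ^ 3 * (β * β * β) ^ 2 ≡ Y * (β * β) * (Y * (β * β)) * (Y * (β * β))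
  lift β = solved Y β
    where
    solved : ∀ Y β → Y * (Y * (Y * 1ℤ)) * ((β * β * β) * ((β * β * β) * 1ℤ)) ≡ Y * (β * β) * (Y * (β * β)) * (Y * (β * β))
    solved = solve-∀
  to : IsCube (Y ^ 3 * c ^ 2) → IsCube c
  to (β , _ , eq) =
    let (δ , _ , c²≡δ³) = cube-cofactor Y (c ^ 2) β Y≢0 eq
        (ε , _ , c≡ε³)  = cube-cofactor c c (δ * δ) c≢0 (fourth-power δ c²≡δ³)
    in ε , (λ ε≡0 → c≢0 (trans c≡ε³ (cong (λ x → x * x * x) ε≡0))) , c≡ε³
  from : IsCube c → IsCube (Y ^ 3 * c ^ 2)
  from (β , β≢0 , c≡β³) = Y * (β * β) , *-≢0 Y≢0 (*-≢0 β≢0 β≢0) ,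
                          trans (cong (λ x → Y ^ 3 * x ^ 2) c≡β³) (lift β)

-- Squares are closed under negation (the paper counts ±β² as squares).
square-neg : ∀ x → IsSquare (- x) ⇔ IsSquare x
square-neg x = mk⇔ to from
  where
  to : IsSquare (- x) → IsSquare x
  to (β , β≢0 , inj₁ eq) = β , β≢0 , inj₂ (trans (sym (ℤP.neg-involutive x)) (cong -_ eq))
  to (β , β≢0 , inj₂ eq) = β , β≢0 , inj₁ (trans (sym (ℤP.neg-involutive x)) (trans (cong -_ eq) (ℤP.neg-involutive _)))
  from : IsSquare x → IsSquare (- x)
  from (β , β≢0 , inj₁ eq) = β , β≢0 , inj₂ (cong -_ eq)
  from (β , β≢0 , inj₂ eq) = β , β≢0 , inj₁ (trans (cong -_ eq) (ℤP.neg-involutive _))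

residue-form : ∀ e n s → n % (suc e ℕ.* 6) ≡ s → n ≡ suc e ℕ.* (n ℕD./ (suc e ℕ.* 6)) ℕ.* 6 ℕ.+ s
residue-form e n s n%≡s = trans (ℕD.m≡m%n+[m/n]*n n (suc e ℕ.* 6))
                                (trans (cong (ℕ._+ n ℕD./ (suc e ℕ.* 6) ℕ.* (suc e ℕ.* 6)) n%≡s)
                                       (rearrange e (n ℕD./ (suc e ℕ.* 6)) s))
  where
  rearrange : ∀ e q s → s ℕ.+ q ℕ.* (suc e ℕ.* 6) ≡ suc e ℕ.* q ℕ.* 6 ℕ.+ s
  rearrange = ℕSolver.solve-∀

module ResidueClasses (α : ℤ) (α≢0 : α ≢ 0ℤ) (α≢-1 : α ≢ -1ℤ) where

  open ClosedForm α
  open SequenceIsClosedForm α α≢0 α≢-1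

  class-form : ∀ e n {s} σ i j C → n % (suc e ℕ.* 6) ≡ s → cfᵐ s ≡ mon σ i j ^ᵐ suc e · C →
               Σ ℤ λ P → P ≢ 0ℤ × hseq α n ≡ P ^ suc e * ⟦ C ⟧
  class-form e n {s} σ i j C n%≡s h-base = P * M , *-≢0 P≢0 (mon≢0 α≢0 (+1≢0 α≢-1) σ i j) , (begin
    hseq α n                         ≡⟨ hseq≡cf n ⟩
    cf n                             ≡⟨ cong cf (residue-form e n s n%≡s) ⟩
    cf (suc e ℕ.* q ℕ.* 6 ℕ.+ s)     ≡⟨ power-multiplier (suc e) q s ⟩
    P ^ suc e * cf s                 ≡⟨ cong (λ m → P ^ suc e * ⟦ m ⟧) h-base ⟩
    P ^ suc e * ⟦ mon σ i j ^ᵐ suc e · C ⟧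
      ≡⟨ cong (P ^ suc e *_) (trans (⟦·⟧ (mon σ i j ^ᵐ suc e) C) (cong (_* ⟦ C ⟧) (⟦^⟧ (mon σ i j) (suc e)))) ⟩
    P ^ suc e * (M ^ suc e * ⟦ C ⟧)  ≡⟨ sym (ℤP.*-assoc (P ^ suc e) (M ^ suc e) ⟦ C ⟧) ⟩
    P ^ suc e * M ^ suc e * ⟦ C ⟧    ≡⟨ cong (_* ⟦ C ⟧) (sym (^-distrib-* P M (suc e))) ⟩
    (P * M) ^ suc e * ⟦ C ⟧          ∎)
    where
    open ≡-Reasoning
    q = n ℕD./ (suc e ℕ.* 6)
    M = ⟦ mon σ i j ⟧
    P = t ^ (q ℕ.* q ℕ.* suc e) * Y q ^ s
    P≢0 : P ≢ 0ℤ
    P≢0 = *-≢0 (^-≢0 (q ℕ.* q ℕ.* suc e) (mon≢0 α≢0 (+1≢0 α≢-1) Sign.+ 15 12))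
               (^-≢0 s (^-≢0 q (mon≢0 α≢0 (+1≢0 α≢-1) Sign.- 5 4)))

  square-class : ∀ n {s} σ i j C {c} → n % 12 ≡ s → cfᵐ s ≡ mon σ i j ^ᵐ 2 · C → ⟦ C ⟧ ≡ c →
                 IsSquare (hseq α n) ⇔ IsSquare c
  square-class n σ i j C n%≡s h-base refl =
    let (P , P≢0 , hₙ≡) = class-form 1 n σ i j C n%≡s h-base in
    subst (λ x → IsSquare x ⇔ IsSquare ⟦ C ⟧) (sym hₙ≡) (square-factor P ⟦ C ⟧ P≢0)

  cube-class : ∀ n {s} σ i j C {c} → n % 18 ≡ s → cfᵐ s ≡ mon σ i j ^ᵐ 3 · C ^ᵐ 2 → ⟦ C ⟧ ≡ c → c ≢ 0ℤ →
               IsCube (hseq α n) ⇔ IsCube c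
  cube-class n σ i j C n%≡s h-base refl c≢0 =
    let (P , P≢0 , hₙ≡) = class-form 2 n σ i j (C ^ᵐ 2) n%≡s h-base in
    subst (λ x → IsCube x ⇔ IsCube ⟦ C ⟧) (sym (trans hₙ≡ (cong (P ^ 3 *_) (⟦^⟧ C 2))))
          (cube-factor P ⟦ C ⟧ P≢0 c≢0)

-- Each refl below is the factorization of the base value h_s, by computation:
-- h₄ = (a³b²)²·b, h₈ = (a¹³b¹⁰)²·(−b), h₄ = (a²b)³·b², h₁₄ = (−a²⁷b²¹)³·b²,
-- h₈ = (−a⁸b⁷)³·a², h₁₀ = (a¹³b¹¹)³·a².
theorem5p6 : (α : ℤ) → α ≢ 0ℤ → α ≢ -1ℤ →
    ((n : ℕ) → (n % 12 ≡ 4 ⊎ n % 12 ≡ 8) → (IsSquare (hseq α n) ⇔ IsSquare (α + 1ℤ)))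
    × ((n : ℕ) → (n % 18 ≡ 4 ⊎ n % 18 ≡ 14) → (IsCube (hseq α n) ⇔ IsCube (α + 1ℤ)))
    × ((n : ℕ) → (n % 18 ≡ 8 ⊎ n % 18 ≡ 10) → (IsCube (hseq α n) ⇔ IsCube α))
theorem5p6 α α≢0 α≢-1 =
    (λ { n (inj₁ n≡4)  → square-class n Sign.+ 3 2 bᵐ n≡4 refl ⟦bᵐ⟧
       ; n (inj₂ n≡8)  → ⇔.trans (square-class n Sign.+ 13 10 (mon Sign.- 0 1) n≡8 refl (cong -_ ⟦bᵐ⟧))
                                 (square-neg (α + 1ℤ)) })
  , (λ { n (inj₁ n≡4)  → cube-class n Sign.+ 2 1 bᵐ n≡4 refl ⟦bᵐ⟧ (+1≢0 α≢-1)
       ; n (inj₂ n≡14) → cube-class n Sign.- 27 21 bᵐ n≡14 refl ⟦bᵐ⟧ (+1≢0 α≢-1) })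
  , (λ { n (inj₁ n≡8)  → cube-class n Sign.- 8 7 aᵐ n≡8 refl ⟦aᵐ⟧ α≢0
       ; n (inj₂ n≡10) → cube-class n Sign.+ 13 11 aᵐ n≡10 refl ⟦aᵐ⟧ α≢0 })
  where
  open ResidueClasses α α≢0 α≢-1
  open ClosedForm α using (⟦_⟧)
  aᵐ bᵐ : Mono
  aᵐ = mon Sign.+ 1 0
  bᵐ = mon Sign.+ 0 1
  ⟦aᵐ⟧ : ⟦ aᵐ ⟧ ≡ α
  ⟦aᵐ⟧ = trans (ℤP.*-identityʳ (α * 1ℤ)) (ℤP.*-identityʳ α)
  ⟦bᵐ⟧ : ⟦ bᵐ ⟧ ≡ α + 1ℤ
  ⟦bᵐ⟧ = trans (ℤP.*-identityˡ ((α + 1ℤ) * 1ℤ)) (ℤP.*-identityʳ (α + 1ℤ))
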